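{- Let $\mathbb{F}$ be a field, $\mathcal{S}\subseteq\mathbb{F}$ with $|\mathcal{S}|=s\ge 2$, and $t=s^3$. For every integer $0\le d'\le s-1$, the function $f_{d'}:\mathcal{B}(\mathcal{S},t)\to\mathbb{F}$, $f_{d'}(z)=z_1^{d'}$, has degree exactly $d'$: it agrees on $\mathcal{B}(\mathcal{S},t)$ with a polynomial of total degree $d'$ but with no polynomial in $\mathbb{F}[z_1,\dots,z_t]$ of total degree at most $d'-1$.
   Context: $\mathcal{B}(\mathcal{S},t)\subseteq\mathcal{S}^t$ is the set of tuples $(z_1,\dots,z_t)\in\mathcal{S}^t$ containing each element of $\mathcal{S}$ exactly $t/s$ times. -}

module Defs where

open import Level using (Level; _⊔_)
open import Data.Nat as ℕ using (ℕ; zero; suc; _<_; _≤_; s≤s; z≤n)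
open import Data.Nat.Properties using (m^n>0)
open import Data.Fin as Fin using (Fin; fromℕ<)
open import Data.Fin.Properties using (_≟_)
open import Data.List using (List; []; _∷_; length; filter; foldr)
open import Data.List.Relation.Unary.All using (All)
open import Data.Product using (Σ; _×_; _,_; proj₁; proj₂)
open import Function.Definitions using (Injective)
open import Relation.Binary.PropositionalEquality using (_≡_)
open import Relation.Nullary using (¬_)
open import Algebra.Bundles using (CommutativeRing)

record Field (c ℓ : Level) : Set (Level.suc (c ⊔ ℓ)) where
  field
    commutativeRing : CommutativeRing c ℓ
  open CommutativeRing commutativeRing public
  field
    0≉1     : ¬ (0# ≈ 1#)
    inverse : ∀ x → ¬ (x ≈ 0#) → Σ Carrier λ y → (x * y) ≈ 1#

count : ∀ {n m} → (Fin n → Fin m) → Fin m → ℕ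
count {n} w j = length (filter (λ i → w i ≟ j) (Data.List.Base.allFin n))
  where import Data.List.Base

module Poly {c ℓ} (𝔽 : Field c ℓ) where
  open Field 𝔽

  pow : Carrier → ℕ → Carrier
  pow x zero    = 1#
  pow x (suc n) = x * pow x n

  Exponent : ℕ → Set
  Exponent t = Fin t → ℕ

  totalDeg : ∀ {t} → Exponent t → ℕ
  totalDeg {zero}  α = 0
  totalDeg {suc t} α = α Fin.zero ℕ.+ totalDeg (λ i → α (Fin.suc i))

  monomial : ∀ {t} → Exponent t → (Fin t → Carrier) → Carrier
  monomial {zero}  α z = 1#
  monomial {suc t} α z =
    pow (z Fin.zero) (α Fin.zero) * monomial (λ i → α (Fin.suc i)) (λ i → z (Fin.suc i))

  Polynomial : ℕ → Set c
  Polynomial t = List (Carrier × Exponent t)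

  eval : ∀ {t} → Polynomial t → (Fin t → Carrier) → Carrier
  eval p z = foldr (λ m acc → (proj₁ m * monomial (proj₂ m) z) + acc) 0# p

  DegLe : ∀ {t} → Polynomial t → ℕ → Set c
  DegLe p d = All (λ m → totalDeg (proj₂ m) ≤ d) p

  -- total degree at most d - 1 (i.e. < d); for d = 0 this forces the
  -- zero polynomial (degree -∞)
  DegLt : ∀ {t} → Polynomial t → ℕ → Set c
  DegLt p d = All (λ m → totalDeg (proj₂ m) < d) p

-- S ⊆ F with |S| = s is given by an injective map
-- σ : Fin s → F (an enumeration of S).  A tuple in S^t is σ ∘ w for a
-- unique w : Fin t → Fin s; it lies in B(S,t) iff each element of S occurs
-- exactly t/s times.

InB : ∀ {s} (t : ℕ) → (Fin t → Fin s) → Set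
InB {s} t w = ∀ (j : Fin s) → count w j ℕ.* s ≡ t

-- the index 1 (first coordinate) of Fin (s ^ 3) when s ≥ 2
first : ∀ s → 2 ≤ s → Fin (s ℕ.^ 3)
first (suc s) _ = fromℕ< (m^n>0 (suc s) 3)

module Submission where

-- The polynomial z₁^d′ witnesses the upper bound. For the lower bound, B(S,t) is closed under permutations
-- of the coordinates and contains the word whose i-th letter is the leading base-s digit of i; that word
-- carries the distinct letters j at the positions pⱼ = j·s². Put u = p₀ and suppose q has degree < d+1 and
-- equals z_u^(d+1) on the words of B whose letter at u is one of 0,…,d+1 and which keep letter j at pⱼ for
-- every j > d+1. If moreover the letter at u is one of 0,…,d, transposing u and v = p_(d+1) stays inside that
-- set, so the divided difference (q(z) − q(τz)) / (z_u − z_v), a polynomial of degree < d, equals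
-- (x^(d+1) − a^(d+1)) / (x − a) = x^d + Σ_{k<d} a^(d−k) x^k with x = z_u, a = σ(d+1). Subtracting the sum
-- gives the same situation one degree lower. At degree 0 the polynomial vanishes, yet should agree with 1.

open import Defs
open import Data.Nat as ℕ using (ℕ; zero; suc; _≤_; _<_; _^_; z≤n; s≤s)
import Data.Nat.Properties as ℕₚ
open import Data.Fin using (Fin; zero; suc; toℕ; fromℕ<; _↑ˡ_; _↑ʳ_; combine; quotient)
open import Data.Fin.Properties using (_≟_; toℕ-fromℕ<; remQuot-combine; combine-injectiveˡ)
open import Data.Fin.Permutation using (Permutation; _⟨$⟩ʳ_)
import Data.Fin.Permutation as Perm
import Data.Fin.Permutation.Components as PC
open import Data.List using ([]; _∷_; length; filter; tabulate)
open import Data.List.Relation.Unary.All using ([]; _∷_)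
open import Data.Bool using (true; false; if_then_else_)
open import Data.Product using (Σ; _×_; _,_; proj₁; proj₂)
open import Function using (_∘_; id)
open import Function.Definitions using (Injective)
open import Relation.Nullary using (Dec; does; yes; no; ¬_; contradiction)
open import Relation.Unary using (Pred; Decidable)
open import Relation.Binary.PropositionalEquality as ≡ using (_≡_; _≢_; module ≡-Reasoning)
open import Algebra.Properties.CommutativeMonoid.Sum ℕₚ.+-0-commutativeMonoid
  using (sum-syntax; ∑-permute; ∑-comm; sum-cong-≗; sum-replicate-zero)

𝟙 : ∀ {a} {A : Set a} → Dec A → ℕ
𝟙 A? = if does A? then 1 else 0

length-filter-tabulate : ∀ {a p n} {A : Set a} {P : Pred A p} (P? : Decidable P) (f : Fin n → A) →
                         length (filter P? (tabulate f)) ≡ ∑[ i < n ] 𝟙 (P? (f i))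
length-filter-tabulate {n = zero}  P? f = ≡.refl
length-filter-tabulate {n = suc n} P? f with does (P? (f zero))
... | true  = ≡.cong suc (length-filter-tabulate P? (f ∘ suc))
... | false = length-filter-tabulate P? (f ∘ suc)

count≡∑ : ∀ {n s} (w : Fin n → Fin s) j → count w j ≡ ∑[ i < n ] 𝟙 (w i ≟ j)
count≡∑ w j = length-filter-tabulate (λ i → w i ≟ j) id

count-∘-permutation : ∀ {n s} (π : Permutation n n) (w : Fin n → Fin s) j →
                      count (w ∘ (π ⟨$⟩ʳ_)) j ≡ count w j
count-∘-permutation π w j = begin
  count (w ∘ (π ⟨$⟩ʳ_)) j          ≡⟨ count≡∑ (w ∘ (π ⟨$⟩ʳ_)) j ⟩
  ∑[ i < _ ] 𝟙 (w (π ⟨$⟩ʳ i) ≟ j)  ≡⟨ ∑-permute (λ i → 𝟙 (w i ≟ j)) π ⟨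
  ∑[ i < _ ] 𝟙 (w i ≟ j)           ≡⟨ count≡∑ w j ⟨
  count w j                        ∎
  where open ≡-Reasoning

InB-∘-permutation : ∀ {s t} {w : Fin t → Fin s} (π : Permutation t t) → InB t w → InB t (w ∘ (π ⟨$⟩ʳ_))
InB-∘-permutation {s} {w = w} π w∈B j = ≡.trans (≡.cong (ℕ._* s) (count-∘-permutation π w j)) (w∈B j)

∑-↑ : ∀ {m n} (f : Fin (m ℕ.+ n) → ℕ) →
      ∑[ i < m ℕ.+ n ] f i ≡ ∑[ i < m ] f (i ↑ˡ n) ℕ.+ ∑[ i < n ] f (m ↑ʳ i)
∑-↑ {zero}      f = ≡.refl
∑-↑ {suc m} {n} f = ≡.trans (≡.cong (f zero ℕ.+_) (∑-↑ {m} {n} (f ∘ suc))) (≡.sym (ℕₚ.+-assoc (f zero) _ _))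

∑-combine : ∀ {m n} (f : Fin (m ℕ.* n) → ℕ) →
            ∑[ i < m ℕ.* n ] f i ≡ ∑[ a < m ] ∑[ b < n ] f (combine a b)
∑-combine {zero}      f = ≡.refl
∑-combine {suc m} {n} f =
  ≡.trans (∑-↑ {n} {m ℕ.* n} f) (≡.cong (∑[ b < n ] f (b ↑ˡ (m ℕ.* n)) ℕ.+_) (∑-combine {m} {n} (f ∘ (n ↑ʳ_))))

∑-𝟙-≟ : ∀ {n} (j : Fin n) → ∑[ a < n ] 𝟙 (a ≟ j) ≡ 1
∑-𝟙-≟ {suc n} zero    = ≡.cong suc (sum-replicate-zero n)
∑-𝟙-≟         (suc j) = ∑-𝟙-≟ j

∑-1 : ∀ n → ∑[ i < n ] 1 ≡ n
∑-1 zero    = ≡.refl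
∑-1 (suc n) = ≡.cong suc (∑-1 n)

count-quotient : ∀ {m} n (j : Fin m) → count (quotient {m} n) j ≡ n
count-quotient {m} n j = begin
  count (quotient n) j                                    ≡⟨ count≡∑ (quotient n) j ⟩
  ∑[ i < m ℕ.* n ] 𝟙 (quotient n i ≟ j)                   ≡⟨ ∑-combine {m} {n} (λ i → 𝟙 (quotient n i ≟ j)) ⟩
  ∑[ a < m ] ∑[ b < n ] 𝟙 (quotient n (combine a b) ≟ j) ≡⟨ sum-cong-≗ {m} (λ a → sum-cong-≗ {n} (λ b →
                                                               ≡.cong (λ x → 𝟙 (x ≟ j)) (quotient-combine a b))) ⟩
  ∑[ a < m ] ∑[ b < n ] 𝟙 (a ≟ j)                         ≡⟨ ∑-comm {m} {n} (λ a _ → 𝟙 (a ≟ j)) ⟩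
  ∑[ b < n ] ∑[ a < m ] 𝟙 (a ≟ j)                         ≡⟨ sum-cong-≗ {n} (λ _ → ∑-𝟙-≟ j) ⟩
  ∑[ b < n ] 1                                            ≡⟨ ∑-1 n ⟩
  n                                                       ∎
  where
  open ≡-Reasoning
  quotient-combine : ∀ a b → quotient n (combine a b) ≡ a
  quotient-combine a b = ≡.cong proj₁ (remQuot-combine {k = n} a b)

InB-quotient : ∀ {s} n → InB (s ℕ.* n) (quotient {s} n)
InB-quotient {s} n j = ≡.trans (≡.cong (ℕ._* s) (count-quotient n j)) (ℕₚ.*-comm n s)

transposeˡ : ∀ {n} (i j : Fin n) → PC.transpose i j i ≡ j
transposeˡ i j with i ≟ i
... | yes _   = ≡.refl
... | no i≢i = contradiction ≡.refl i≢i

transpose-fixes : ∀ {n} {i j k : Fin n} → k ≢ i → k ≢ j → PC.transpose i j k ≡ k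
transpose-fixes {i = i} {j} {k} k≢i k≢j with k ≟ i
... | yes k≡i = contradiction k≡i k≢i
... | no _ with k ≟ j
...   | yes k≡j = contradiction k≡j k≢j
...   | no _    = ≡.refl

module PolynomialDegree {c ℓ} (𝔽 : Field c ℓ) where
  open Field 𝔽 hiding (zero)
  open Poly 𝔽
  open import Algebra.Properties.Ring ring using (-1*x≈-x; -‿distribʳ-*)
  open import Algebra.Properties.AbelianGroup +-abelianGroup using (⁻¹-anti-homo‿-)
  open import Algebra.Properties.Group +-group using (∙-cancelˡ; x∙y⁻¹≈ε⇒x≈y)
  open import Algebra.Properties.CommutativeSemigroup +-commutativeSemigroup
    using (interchange) renaming (x∙yz≈y∙xz to x+[y+z]≈y+[x+z])
  open import Algebra.Properties.CommutativeSemigroup *-commutativeSemigroup using (x∙yz≈y∙xz)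
  open import Relation.Binary.Reasoning.Setoid setoid

  x+[y-x]≈y : ∀ x y → x + (y - x) ≈ y
  x+[y-x]≈y x y = begin
    x + (y - x)    ≈⟨ +-comm x (y - x) ⟩
    (y - x) + x    ≈⟨ +-assoc y (- x) x ⟩
    y + (- x + x)  ≈⟨ +-congˡ (-‿inverseˡ x) ⟩
    y + 0#         ≈⟨ +-identityʳ y ⟩
    y              ∎

  x≈x+y*0 : ∀ x y → x ≈ x + y * 0#
  x≈x+y*0 x y = sym (trans (+-congˡ (zeroʳ y)) (+-identityʳ x))

  *-cancelˡ-≉0 : ∀ {a x y} → ¬ a ≈ 0# → a * x ≈ a * y → x ≈ y
  *-cancelˡ-≉0 {a} {x} {y} a≉0 ax≈ay with inverse a a≉0
  ... | a⁻¹ , aa⁻¹≈1 = begin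
    x              ≈⟨ *-identityˡ x ⟨
    1# * x         ≈⟨ *-congʳ (trans (sym aa⁻¹≈1) (*-comm a a⁻¹)) ⟩
    (a⁻¹ * a) * x  ≈⟨ *-assoc a⁻¹ a x ⟩
    a⁻¹ * (a * x)  ≈⟨ *-congˡ ax≈ay ⟩
    a⁻¹ * (a * y)  ≈⟨ *-assoc a⁻¹ a y ⟨
    (a⁻¹ * a) * y  ≈⟨ *-congʳ (trans (*-comm a⁻¹ a) aa⁻¹≈1) ⟩
    1# * y         ≈⟨ *-identityˡ y ⟩
    y              ∎

  pow-congˡ : ∀ {x y} n → x ≈ y → pow x n ≈ pow y n
  pow-congˡ zero    x≈y = refl
  pow-congˡ (suc n) x≈y = *-cong x≈y (pow-congˡ n x≈y)

  geo : Carrier → Carrier → ℕ → Carrier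
  geo a x zero    = 0#
  geo a x (suc d) = pow a (suc d) + x * geo a x d

  pow-difference : ∀ a x d → pow x (suc d) ≈ pow a (suc d) + (x - a) * (pow x d + geo a x d)
  pow-difference a x zero = begin
    x * 1#                        ≈⟨ *-identityʳ x ⟩
    x                             ≈⟨ x+[y-x]≈y a x ⟨
    a + (x - a)                   ≈⟨ +-cong (*-identityʳ a) (trans (*-congˡ (+-identityʳ 1#)) (*-identityʳ _)) ⟨
    a * 1# + (x - a) * (1# + 0#)  ∎
  pow-difference a x (suc d) = begin
    x * X                                             ≈⟨ *-congˡ (pow-difference a x d) ⟩
    x * (A + (x - a) * (P + g))                       ≈⟨ distribˡ x A _ ⟩
    x * A + x * ((x - a) * (P + g))                   ≈⟨ +-cong (*-congʳ (x+[y-x]≈y a x))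
                                                                (x∙yz≈y∙xz (x - a) x (P + g)) ⟨
    (a + (x - a)) * A + (x - a) * (x * (P + g))       ≈⟨ +-cong (distribʳ A a (x - a)) (*-congˡ (distribˡ x P g)) ⟩
    (a * A + (x - a) * A) + (x - a) * (x * P + x * g) ≈⟨ +-assoc _ _ _ ⟩
    a * A + ((x - a) * A + (x - a) * (x * P + x * g)) ≈⟨ +-congˡ (distribˡ (x - a) A _) ⟨
    a * A + (x - a) * (A + (x * P + x * g))           ≈⟨ +-congˡ (*-congˡ (x+[y+z]≈y+[x+z] A (x * P) (x * g))) ⟩
    a * A + (x - a) * (x * P + (A + x * g))           ∎
    where
    X A P g : Carrier
    X = pow x (suc d)
    A = pow a (suc d)
    P = pow x d
    g = geo a x d

  -- Expr T n: polynomial expressions in T variables of total degree < n; v ⋆ e stands for z_v · e.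
  infixr 6 _⊕_
  infixr 7 _⊙_ _⋆_

  data Expr (T : ℕ) : ℕ → Set c where
    0ᴱ  : ∀ {n} → Expr T n
    con : ∀ {n} → Carrier → Expr T (suc n)
    _⊕_ : ∀ {n} → Expr T n → Expr T n → Expr T n
    _⊙_ : ∀ {n} → Carrier → Expr T n → Expr T n
    _⋆_ : ∀ {n} → Fin T → Expr T n → Expr T (suc n)

  ⟦_⟧ : ∀ {T n} → Expr T n → (Fin T → Carrier) → Carrier
  ⟦ 0ᴱ    ⟧ z = 0#
  ⟦ con a ⟧ z = a
  ⟦ e ⊕ f ⟧ z = ⟦ e ⟧ z + ⟦ f ⟧ z
  ⟦ a ⊙ e ⟧ z = a * ⟦ e ⟧ z
  ⟦ v ⋆ e ⟧ z = z v * ⟦ e ⟧ z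

  ⟦⟧-degree<0 : ∀ {T} (e : Expr T 0) z → ⟦ e ⟧ z ≈ 0#
  ⟦⟧-degree<0 0ᴱ      z = refl
  ⟦⟧-degree<0 (e ⊕ f) z = trans (+-cong (⟦⟧-degree<0 e z) (⟦⟧-degree<0 f z)) (+-identityʳ 0#)
  ⟦⟧-degree<0 (a ⊙ e) z = trans (*-congˡ (⟦⟧-degree<0 e z)) (zeroʳ a)

  lift≤ : ∀ {T m n} → m ≤ n → Expr T m → Expr T n
  lift≤ _         0ᴱ      = 0ᴱ
  lift≤ (s≤s _)   (con a) = con a
  lift≤ m≤n       (e ⊕ f) = lift≤ m≤n e ⊕ lift≤ m≤n f
  lift≤ m≤n       (a ⊙ e) = a ⊙ lift≤ m≤n e
  lift≤ (s≤s m≤n) (v ⋆ e) = v ⋆ lift≤ m≤n e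

  ⟦lift≤⟧ : ∀ {T m n} (m≤n : m ≤ n) (e : Expr T m) z → ⟦ lift≤ m≤n e ⟧ z ≡ ⟦ e ⟧ z
  ⟦lift≤⟧ _         0ᴱ      z = ≡.refl
  ⟦lift≤⟧ (s≤s _)   (con a) z = ≡.refl
  ⟦lift≤⟧ m≤n       (e ⊕ f) z = ≡.cong₂ _+_ (⟦lift≤⟧ m≤n e z) (⟦lift≤⟧ m≤n f z)
  ⟦lift≤⟧ m≤n       (a ⊙ e) z = ≡.cong (a *_) (⟦lift≤⟧ m≤n e z)
  ⟦lift≤⟧ (s≤s m≤n) (v ⋆ e) z = ≡.cong (z v *_) (⟦lift≤⟧ m≤n e z)

  _^_·_ : ∀ {T n} → Fin T → (k : ℕ) → Expr T n → Expr T (k ℕ.+ n)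
  v ^ zero  · e = e
  v ^ suc k · e = v ⋆ (v ^ k · e)

  ⟦^·⟧ : ∀ {T n} (v : Fin T) k (e : Expr T n) z → ⟦ v ^ k · e ⟧ z ≈ pow (z v) k * ⟦ e ⟧ z
  ⟦^·⟧ v zero    e z = sym (*-identityˡ _)
  ⟦^·⟧ v (suc k) e z = trans (*-congˡ (⟦^·⟧ v k e z)) (sym (*-assoc (z v) _ _))

  monomialᴱ : ∀ {T k} (α : Exponent k) → (Fin k → Fin T) → Expr T (suc (totalDeg α))
  monomialᴱ {k = zero}  α f = con 1#
  monomialᴱ {k = suc k} α f =
    lift≤ (ℕₚ.≤-reflexive (ℕₚ.+-suc (α zero) _)) (f zero ^ α zero · monomialᴱ (α ∘ suc) (f ∘ suc))

  ⟦monomialᴱ⟧ : ∀ {T k} (α : Exponent k) (f : Fin k → Fin T) z → ⟦ monomialᴱ α f ⟧ z ≈ monomial α (z ∘ f)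
  ⟦monomialᴱ⟧ {k = zero}  α f z = refl
  ⟦monomialᴱ⟧ {k = suc k} α f z = begin
    ⟦ lift≤ _ (f zero ^ α zero · e) ⟧ z   ≡⟨ ⟦lift≤⟧ _ (f zero ^ α zero · e) z ⟩
    ⟦ f zero ^ α zero · e ⟧ z             ≈⟨ ⟦^·⟧ (f zero) (α zero) e z ⟩
    pow (z (f zero)) (α zero) * ⟦ e ⟧ z   ≈⟨ *-congˡ (⟦monomialᴱ⟧ (α ∘ suc) (f ∘ suc) z) ⟩
    monomial α (z ∘ f)                    ∎
    where
    e : Expr _ (suc (totalDeg (α ∘ suc)))
    e = monomialᴱ (α ∘ suc) (f ∘ suc)

  polynomialᴱ : ∀ {T d} (p : Polynomial T) → DegLt p d → Expr T d
  polynomialᴱ []            []          = 0ᴱ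
  polynomialᴱ ((a , α) ∷ p) (α<d ∷ p<d) = lift≤ α<d (a ⊙ monomialᴱ α id) ⊕ polynomialᴱ p p<d

  ⟦polynomialᴱ⟧ : ∀ {T d} (p : Polynomial T) (p<d : DegLt p d) z → ⟦ polynomialᴱ p p<d ⟧ z ≈ eval p z
  ⟦polynomialᴱ⟧ []            []          z = refl
  ⟦polynomialᴱ⟧ ((a , α) ∷ p) (α<d ∷ p<d) z = +-cong
    (trans (reflexive (⟦lift≤⟧ α<d (a ⊙ monomialᴱ α id) z)) (*-congˡ (⟦monomialᴱ⟧ α id z)))
    (⟦polynomialᴱ⟧ p p<d z)

  module DividedDifference {T} (u v : Fin T) where

    τ : Fin T → Fin T
    τ = PC.transpose u v

    δ : Fin T → Carrier
    δ w with does (w ≟ u)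
    ... | true  = 1#
    ... | false with does (w ≟ v)
    ...   | true  = - 1#
    ...   | false = 0#

    transpose-difference : ∀ (z : Fin T → Carrier) w → z w ≈ z (τ w) + (z u - z v) * δ w
    transpose-difference z w with w ≟ u
    ... | yes ≡.refl = sym (trans (+-congˡ (*-identityʳ _)) (x+[y-x]≈y (z v) (z u)))
    ... | no _ with w ≟ v
    ...   | yes ≡.refl = sym (begin
      z u + (z u - z v) * - 1#    ≈⟨ +-congˡ (-‿distribʳ-* (z u - z v) 1#) ⟨
      z u + - ((z u - z v) * 1#)  ≈⟨ +-congˡ (-‿cong (*-identityʳ _)) ⟩
      z u + - (z u - z v)         ≈⟨ +-congˡ (⁻¹-anti-homo‿- (z u) (z v)) ⟩
      z u + (z v - z u)           ≈⟨ x+[y-x]≈y (z u) (z v) ⟩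
      z v                         ∎)
    ...   | no _ = x≈x+y*0 (z w) _

    Δ : ∀ {n} → Expr T (suc n) → Expr T n
    Δ 0ᴱ              = 0ᴱ
    Δ (con _)         = 0ᴱ
    Δ (e ⊕ f)         = Δ e ⊕ Δ f
    Δ (a ⊙ e)         = a ⊙ Δ e
    Δ {zero}  (w ⋆ e) = 0ᴱ
    Δ {suc n} (w ⋆ e) = τ w ⋆ Δ e ⊕ δ w ⊙ e

    Δ-correct : ∀ {n} (e : Expr T (suc n)) z → ⟦ e ⟧ z ≈ ⟦ e ⟧ (z ∘ τ) + (z u - z v) * ⟦ Δ e ⟧ z
    Δ-correct 0ᴱ      z = x≈x+y*0 0# _
    Δ-correct (con a) z = x≈x+y*0 a _
    Δ-correct (e ⊕ f) z = sum-rule (Δ-correct e z) (Δ-correct f z)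
      where
      sum-rule : ∀ {a a′ b b′ d x y} → a ≈ a′ + d * x → b ≈ b′ + d * y → a + b ≈ (a′ + b′) + d * (x + y)
      sum-rule {a} {a′} {b} {b′} {d} {x} {y} a≈ b≈ = begin
        a + b                        ≈⟨ +-cong a≈ b≈ ⟩
        (a′ + d * x) + (b′ + d * y)  ≈⟨ interchange a′ (d * x) b′ (d * y) ⟩
        (a′ + b′) + (d * x + d * y)  ≈⟨ +-congˡ (distribˡ d x y) ⟨
        (a′ + b′) + d * (x + y)      ∎
    Δ-correct (a ⊙ e) z = scalar-rule (Δ-correct e z)
      where
      scalar-rule : ∀ {b b′ d x} → b ≈ b′ + d * x → a * b ≈ a * b′ + d * (a * x)
      scalar-rule {b} {b′} {d} {x} b≈ = begin
        a * b                 ≈⟨ *-congˡ b≈ ⟩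
        a * (b′ + d * x)      ≈⟨ distribˡ a b′ (d * x) ⟩
        a * b′ + a * (d * x)  ≈⟨ +-congˡ (x∙yz≈y∙xz a d x) ⟩
        a * b′ + d * (a * x)  ∎
    Δ-correct {zero}  (w ⋆ e) z = begin
      z w * ⟦ e ⟧ z                                ≈⟨ *-congˡ (⟦⟧-degree<0 e z) ⟩
      z w * 0#                                     ≈⟨ zeroʳ (z w) ⟩
      0#                                           ≈⟨ zeroʳ (z (τ w)) ⟨
      z (τ w) * 0#                                 ≈⟨ *-congˡ (⟦⟧-degree<0 e (z ∘ τ)) ⟨
      z (τ w) * ⟦ e ⟧ (z ∘ τ)                      ≈⟨ x≈x+y*0 _ _ ⟩
      z (τ w) * ⟦ e ⟧ (z ∘ τ) + (z u - z v) * 0#   ∎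
    Δ-correct {suc n} (w ⋆ e) z = product-rule (transpose-difference z w) (Δ-correct e z)
      where
      product-rule : ∀ {a a′ b b′ d x y} → a ≈ a′ + d * x → b ≈ b′ + d * y →
                     a * b ≈ a′ * b′ + d * (a′ * y + x * b)
      product-rule {a} {a′} {b} {b′} {d} {x} {y} a≈ b≈ = begin
        a * b                                   ≈⟨ *-congʳ a≈ ⟩
        (a′ + d * x) * b                        ≈⟨ distribʳ b a′ (d * x) ⟩
        a′ * b + (d * x) * b                    ≈⟨ +-congʳ (*-congˡ b≈) ⟩
        a′ * (b′ + d * y) + (d * x) * b         ≈⟨ +-congʳ (distribˡ a′ b′ (d * y)) ⟩
        (a′ * b′ + a′ * (d * y)) + (d * x) * b  ≈⟨ +-assoc _ _ _ ⟩
        a′ * b′ + (a′ * (d * y) + (d * x) * b)  ≈⟨ +-congˡ (+-cong (x∙yz≈y∙xz a′ d y) (*-assoc d x b)) ⟩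
        a′ * b′ + (d * (a′ * y) + d * (x * b))  ≈⟨ +-congˡ (distribˡ d _ _) ⟨
        a′ * b′ + d * (a′ * y + x * b)          ∎

    geoᴱ : Carrier → (d : ℕ) → Expr T d
    geoᴱ a zero    = 0ᴱ
    geoᴱ a (suc d) = con (pow a (suc d)) ⊕ u ⋆ geoᴱ a d

    ⟦geoᴱ⟧ : ∀ a d z → ⟦ geoᴱ a d ⟧ z ≈ geo a (z u) d
    ⟦geoᴱ⟧ a zero    z = refl
    ⟦geoᴱ⟧ a (suc d) z = +-congˡ (*-congˡ (⟦geoᴱ⟧ a d z))

    module _ {ℓa ℓp} {A : Set ℓa} (σ : A → Carrier) (Q Q′ : Pred (Fin T → A) ℓp) (b : Carrier)
             (Q′⊆Q : ∀ {w} → Q′ w → Q w) (Q′-swap : ∀ {w} → Q′ w → Q (w ∘ τ))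
             (Q′-v : ∀ {w} → Q′ w → σ (w v) ≈ b) (Q′-u : ∀ {w} → Q′ w → ¬ σ (w u) ≈ b) where

      lower-degree : ∀ {d} (e : Expr T (suc d)) →
                     (∀ {w} → Q w → ⟦ e ⟧ (σ ∘ w) ≈ pow (σ (w u)) (suc d)) →
                     Σ (Expr T d) λ e′ → ∀ {w} → Q′ w → ⟦ e′ ⟧ (σ ∘ w) ≈ pow (σ (w u)) d
      lower-degree {d} e agree = Δ e ⊕ - 1# ⊙ geoᴱ b d , agree′
        where
        agree′ : ∀ {w} → Q′ w → ⟦ Δ e ⊕ - 1# ⊙ geoᴱ b d ⟧ (σ ∘ w) ≈ pow (σ (w u)) d
        agree′ {w} w∈Q′ = begin
          ⟦ Δ e ⟧ z + - 1# * ⟦ geoᴱ b d ⟧ z  ≈⟨ +-cong Δe≈ (*-congˡ (⟦geoᴱ⟧ b d z)) ⟩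
          (pow x d + g) + - 1# * g          ≈⟨ +-congˡ (-1*x≈-x g) ⟩
          (pow x d + g) - g                 ≈⟨ +-assoc _ _ _ ⟩
          pow x d + (g - g)                 ≈⟨ +-congˡ (-‿inverseʳ g) ⟩
          pow x d + 0#                      ≈⟨ +-identityʳ _ ⟩
          pow x d                           ∎
          where
          z : Fin T → Carrier
          z = σ ∘ w
          x g : Carrier
          x = σ (w u)
          g = geo b x d
          swapped : ⟦ e ⟧ (z ∘ τ) ≈ pow b (suc d)
          swapped = trans (agree (Q′-swap w∈Q′))
                          (pow-congˡ (suc d) (trans (reflexive (≡.cong z (transposeˡ u v))) (Q′-v w∈Q′)))
          two-expansions : pow b (suc d) + (x - b) * ⟦ Δ e ⟧ z ≈ pow b (suc d) + (x - b) * (pow x d + g)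
          two-expansions = begin
            pow b (suc d) + (x - b) * ⟦ Δ e ⟧ z      ≈⟨ +-cong swapped (*-congʳ (+-congˡ (-‿cong (Q′-v w∈Q′)))) ⟨
            ⟦ e ⟧ (z ∘ τ) + (x - z v) * ⟦ Δ e ⟧ z    ≈⟨ Δ-correct e z ⟨
            ⟦ e ⟧ z                                  ≈⟨ agree (Q′⊆Q w∈Q′) ⟩
            pow x (suc d)                            ≈⟨ pow-difference b x d ⟩
            pow b (suc d) + (x - b) * (pow x d + g)  ∎
          Δe≈ : ⟦ Δ e ⟧ z ≈ pow x d + g
          Δe≈ = *-cancelˡ-≉0 (Q′-u w∈Q′ ∘ x∙y⁻¹≈ε⇒x≈y x b) (∙-cancelˡ (pow b (suc d)) _ _ two-expansions)

  module Descent {n T ℓp} (σ : Fin (suc n) → Carrier) (σ-injective : Injective _≡_ _≈_ σ)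
                 (P : Pred (Fin T → Fin (suc n)) ℓp)
                 (P-transpose : ∀ {w} i j → P w → P (w ∘ PC.transpose i j))
                 (pos : Fin (suc n) → Fin T) (pos-injective : Injective _≡_ _≡_ pos)
                 (w₀ : Fin T → Fin (suc n)) (w₀∈P : P w₀) (w₀∘pos : ∀ j → w₀ (pos j) ≡ j) where

    u : Fin T
    u = pos zero

    record Stage (k : ℕ) (w : Fin T → Fin (suc n)) : Set ℓp where
      field
        inP   : P w
        head≤ : toℕ (w u) ≤ k
        fixed : ∀ j → k < toℕ j → w (pos j) ≡ j
    open Stage

    stage₀ : Stage 0 w₀
    stage₀ = record
      { inP   = w₀∈P
      ; head≤ = ℕₚ.≤-reflexive (≡.cong toℕ (w₀∘pos zero))
      ; fixed = λ j _ → w₀∘pos j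
      }

    pos-≢ : ∀ {i j} → toℕ i ≢ toℕ j → pos i ≢ pos j
    pos-≢ i≢j pi≡pj = i≢j (≡.cong toℕ (pos-injective pi≡pj))

    module _ {d} {j₁ : Fin (suc n)} (j₁≡d+1 : toℕ j₁ ≡ suc d) where

      stage-weaken : ∀ {w} → Stage d w → Stage (suc d) w
      stage-weaken st = record
        { inP   = inP st
        ; head≤ = ℕₚ.m≤n⇒m≤1+n (head≤ st)
        ; fixed = λ j d+1<j → fixed st j (ℕₚ.<-trans (ℕₚ.n<1+n d) d+1<j)
        }

      fixed-j₁ : ∀ {w} → Stage d w → w (pos j₁) ≡ j₁
      fixed-j₁ st = fixed st j₁ (ℕₚ.≤-reflexive (≡.sym j₁≡d+1))

      stage-swap : ∀ {w} → Stage d w → Stage (suc d) (w ∘ PC.transpose u (pos j₁))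
      stage-swap {w} st = record
        { inP   = P-transpose u (pos j₁) (inP st)
        ; head≤ = ℕₚ.≤-reflexive (≡.trans (≡.cong toℕ head≡j₁) j₁≡d+1)
        ; fixed = λ j d+1<j → ≡.trans (≡.cong w (untouched d+1<j)) (fixed st j (ℕₚ.<-trans (ℕₚ.n<1+n d) d+1<j))
        }
        where
        head≡j₁ : w (PC.transpose u (pos j₁) u) ≡ j₁
        head≡j₁ = ≡.trans (≡.cong w (transposeˡ u (pos j₁))) (fixed-j₁ st)
        untouched : ∀ {j} → suc d < toℕ j → PC.transpose u (pos j₁) (pos j) ≡ pos j
        untouched {j} d+1<j = transpose-fixes
          (pos-≢ (ℕₚ.>⇒≢ (ℕₚ.≤-trans (s≤s z≤n) d+1<j)))
          (pos-≢ (≡.subst (toℕ j ≢_) (≡.sym j₁≡d+1) (ℕₚ.>⇒≢ d+1<j)))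

      stage-value : ∀ {w} → Stage d w → σ (w (pos j₁)) ≈ σ j₁
      stage-value st = reflexive (≡.cong σ (fixed-j₁ st))

      stage-head≉ : ∀ {w} → Stage d w → ¬ σ (w u) ≈ σ j₁
      stage-head≉ st σwu≈σj₁ =
        ℕₚ.<-irrefl ≡.refl (≡.subst (_≤ d) (≡.trans (≡.cong toℕ (σ-injective σwu≈σj₁)) j₁≡d+1) (head≤ st))

    no-agreement : ∀ d → d < suc n → (e : Expr T d) →
                   ¬ (∀ {w} → Stage d w → ⟦ e ⟧ (σ ∘ w) ≈ pow (σ (w u)) d)
    no-agreement zero    _     e agree = 0≉1 (trans (sym (⟦⟧-degree<0 e (σ ∘ w₀))) (agree stage₀))
    no-agreement (suc d) d+1<n+1 e agree =
      no-agreement d (ℕₚ.<-trans (ℕₚ.n<1+n d) d+1<n+1) (proj₁ lowered) (proj₂ lowered)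
      where
      j₁ : Fin (suc n)
      j₁ = fromℕ< d+1<n+1
      j₁≡d+1 : toℕ j₁ ≡ suc d
      j₁≡d+1 = toℕ-fromℕ< d+1<n+1
      lowered : Σ (Expr T d) λ e′ → ∀ {w} → Stage d w → ⟦ e′ ⟧ (σ ∘ w) ≈ pow (σ (w u)) d
      lowered = DividedDifference.lower-degree u (pos j₁) σ (Stage (suc d)) (Stage d) (σ j₁)
                  (stage-weaken j₁≡d+1) (stage-swap j₁≡d+1) (stage-value j₁≡d+1) (stage-head≉ j₁≡d+1) e agree

  first-exponent : ∀ {T} → ℕ → Exponent (suc T)
  first-exponent d zero    = d
  first-exponent d (suc _) = 0

  first-power : ∀ {T} → ℕ → Polynomial (suc T)
  first-power d = (1# , first-exponent d) ∷ []

  totalDeg-0 : ∀ T → totalDeg {T} (λ _ → 0) ≡ 0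
  totalDeg-0 zero    = ≡.refl
  totalDeg-0 (suc T) = totalDeg-0 T

  monomial-0 : ∀ {T} (z : Fin T → Carrier) → monomial (λ _ → 0) z ≈ 1#
  monomial-0 {zero}  z = refl
  monomial-0 {suc T} z = trans (*-identityˡ _) (monomial-0 (z ∘ suc))

  first-power-degree : ∀ {T} d → DegLe (first-power {T} d) d
  first-power-degree {T} d = ℕₚ.≤-reflexive (≡.trans (≡.cong (d ℕ.+_) (totalDeg-0 T)) (ℕₚ.+-identityʳ d)) ∷ []

  eval-first-power : ∀ {T} d (z : Fin (suc T) → Carrier) → eval (first-power d) z ≈ pow (z zero) d
  eval-first-power d z =
    trans (+-identityʳ _) (trans (*-identityˡ _) (trans (*-congˡ (monomial-0 (z ∘ suc))) (*-identityʳ _)))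

claim4p5 : ∀ {c ℓ} (𝔽 : Field c ℓ) (s : ℕ) (σ : Fin s → Field.Carrier 𝔽)
    → Injective _≡_ (Field._≈_ 𝔽) σ
    → (2≤s : 2 ≤ s)
    → (d′ : ℕ) → d′ < s
    → (Σ (Poly.Polynomial 𝔽 (s ^ 3)) λ p → Poly.DegLe 𝔽 p d′
         × (∀ (w : Fin (s ^ 3) → Fin s) → InB (s ^ 3) w
              → Field._≈_ 𝔽 (Poly.eval 𝔽 p (λ i → σ (w i)))
                             (Poly.pow 𝔽 (σ (w (first s 2≤s))) d′)))
      × ¬ (Σ (Poly.Polynomial 𝔽 (s ^ 3)) λ p → Poly.DegLt 𝔽 p d′
         × (∀ (w : Fin (s ^ 3) → Fin s) → InB (s ^ 3) w
              → Field._≈_ 𝔽 (Poly.eval 𝔽 p (λ i → σ (w i)))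
                             (Poly.pow 𝔽 (σ (w (first s 2≤s))) d′)))
claim4p5 𝔽 s@(suc (suc _)) σ σ-injective (s≤s (s≤s z≤n)) d′ d′<s =
  (first-power d′ , first-power-degree d′ , λ w _ → eval-first-power d′ (σ ∘ w)) ,
  λ { (p , p<d′ , agree) → no-agreement d′ d′<s (polynomialᴱ p p<d′)
                             (λ {w} st → trans (⟦polynomialᴱ⟧ p p<d′ (σ ∘ w)) (agree w (Stage.inP st))) }
  where
  open PolynomialDegree 𝔽
  open Field 𝔽 using (trans)
  -- pos j = j·s² and w₀ i = the leading base-s digit of i
  open Descent σ σ-injective (InB (s ^ 3)) (λ {w} i j → InB-∘-permutation {w = w} (Perm.transpose i j))
               (λ j → combine {s} {s ^ 2} j zero) (λ {i} {k} → combine-injectiveˡ i zero k zero)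
               (quotient {s} (s ^ 2)) (InB-quotient {s} (s ^ 2)) (λ j → ≡.cong proj₁ (remQuot-combine j zero))
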